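{- Let $S$ be a numerical semigroup. If $W_0(S)\ge 0$, then $W(S)\ge 0$, i.e. $S$ satisfies Wilf's conjecture.
   Context: A numerical semigroup is a submonoid $S\subseteq\mathbb N=\{0,1,2,\dots\}$ (containing $0$ and closed under addition) with finite complement in $\mathbb N$. Let $S^*=S\setminus\{0\}$. The multiplicity of $S$ is $m=\min S^*$; its conductor $c$ is the least integer with $c+\mathbb N\subseteq S$. Set $q=\lceil c/m\rceil$ and $\rho=qm-c$. Let $P$ be the set of primitive elements of $S$ (elements of $S^*$ that cannot be written as $a_1+a_2$ with $a_1,a_2\in S^*$), $D=S^*+S^*=S^*\setminus P$, $L=S\cap\{0,1,\dots,c-1\}$, and $D_q=D\cap\{c,c+1,\dots,c+m-1\}$. Define $W(S)=|P||L|-c$ and $W_0(S)=|P\cap L||L|-q|D_q|+\rho$. Wilf's conjecture is the statement $W(S)\ge 0$. -}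

module Defs where

open import Level using (0ℓ)
open import Data.Nat using (ℕ; zero; suc; _+_; _*_; _∸_; _≤_; _<_)
open import Data.Nat.DivMod using (_/_)
open import Data.Product using (Σ; ∃; _×_; _,_)
open import Data.List using (List; length)
open import Data.List.Membership.Propositional using (_∈_)
open import Data.List.Relation.Unary.Unique.Propositional using (Unique)
open import Relation.Nullary using (¬_)
open import Relation.Binary.PropositionalEquality using (_≡_)
open import Function.Bundles using (_⇔_)

SubsetOfℕ : Set₁
SubsetOfℕ = ℕ → Set

record IsNumericalSemigroup (S : SubsetOfℕ) : Set where
  field
    zero∈        : S 0
    closed       : ∀ {a b} → S a → S b → S (a + b)
    cofinite     : ∃ λ N → ∀ n → N ≤ n → S n

NonZeroElem : SubsetOfℕ → SubsetOfℕ
NonZeroElem S n = S n × ¬ (n ≡ 0)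

IsMultiplicity : SubsetOfℕ → ℕ → Set
IsMultiplicity S m = NonZeroElem S m × (∀ n → NonZeroElem S n → m ≤ n)

IsConductor : SubsetOfℕ → ℕ → Set
IsConductor S c = (∀ n → c ≤ n → S n) × (∀ c' → (∀ n → c' ≤ n → S n) → c ≤ c')

Decomposable : SubsetOfℕ → SubsetOfℕ
Decomposable S n = Σ ℕ λ a → Σ ℕ λ b →
  NonZeroElem S a × NonZeroElem S b × n ≡ a + b

Primitive : SubsetOfℕ → SubsetOfℕ
Primitive S n = NonZeroElem S n × ¬ Decomposable S n

Left : SubsetOfℕ → ℕ → SubsetOfℕ
Left S c n = S n × n < c

PrimitiveLeft : SubsetOfℕ → ℕ → SubsetOfℕ
PrimitiveLeft S c n = Primitive S n × n < c

DecomposableQ : SubsetOfℕ → ℕ → ℕ → SubsetOfℕ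
DecomposableQ S c m n = Decomposable S n × c ≤ n × n < c + m

HasCard : SubsetOfℕ → ℕ → Set
HasCard A k = Σ (List ℕ) λ xs →
  Unique xs × (∀ n → (n ∈ xs) ⇔ A n) × length xs ≡ k

-- ceiling division ⌈c/m⌉ (the m = 0 case is irrelevant: multiplicity ≥ 1)
ceilDiv : ℕ → ℕ → ℕ
ceilDiv c zero    = 0
ceilDiv c (suc k) = (c + k) / suc k

module Submission where

open import Defs
open import Data.Nat using (ℕ; _*_; _∸_)
open import Data.Integer using (ℤ; +_; _-_; _+_; _≤_)
open import Data.Integer using () renaming (_*_ to _*ℤ_)

open import Data.Nat as ℕ using (zero; suc; z≤n; s≤s; _<_; _≟_; _≤?_)
  renaming (_≤_ to _≤ℕ_; _+_ to _+ℕ_)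
import Data.Nat.Properties as ℕ
import Data.Integer as ℤ
import Data.Integer.Properties as ℤ
open import Data.Nat.DivMod using (_%_; m≡m%n+[m/n]*n; m%n<n; m/n*n≤m)
open import Data.List using (List; length; _++_; filter; deduplicate; applyUpTo)
open import Data.List.Properties
  using (length-++; length-filter; length-deduplicate; length-applyUpTo)
open import Data.List.Membership.Propositional using (_∈_)
open import Data.List.Membership.Propositional.Properties
  using (∈-++⁺ˡ; ∈-++⁺ʳ; ∈-++⁻; ∈-filter⁺; ∈-filter⁻;
         ∈-deduplicate⁺; ∈-applyUpTo⁻)
open import Data.List.Membership.Propositional.Properties.WithK using (unique∧set⇒bag)
open import Data.List.Membership.DecPropositional using () renaming (_∈?_ to member?)
open import Data.List.Relation.Unary.Unique.Propositional using (Unique)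
open import Data.List.Relation.Unary.Unique.Propositional.Properties
  using (filter⁺; ++⁺; applyUpTo⁺₁)
open import Data.List.Relation.Unary.Unique.DecPropositional.Properties using (deduplicate-!)
open import Data.List.Relation.Binary.BagAndSetEquality using (∼bag⇒↭)
open import Data.List.Relation.Binary.Permutation.Propositional.Properties using (↭-length)
open import Data.Product using (∃-syntax; _×_; _,_; proj₁; proj₂)
open import Data.Sum using (_⊎_; inj₁; inj₂)
open import Data.Empty using (⊥; ⊥-elim)
open import Function.Bundles using (_⇔_; mk⇔; Equivalence)
open import Relation.Nullary using (¬_; yes; no)
open import Relation.Nullary.Decidable using (map′)
open import Relation.Unary using (Decidable)
open import Relation.Binary.Definitions using (DecidableEquality)
open import Relation.Binary.PropositionalEquality using (_≡_; refl; sym; trans; cong; subst; subst₂)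

-- Write P = P∩L ⊔ K with K = {x ∈ P | x ≥ c}, so that
-- |P| ≥ |P∩L| + |K|.  Every element of the window [c, c+m) lies in S*
-- (when c > 0), hence is either primitive (so in K) or decomposable (so in
-- D_q): m ≤ |K| + |D_q|.  The multiples 0, m, …, (q-1)m lie in L, so
-- q ≤ |L|.  With c + ρ = qm these three counts give
--   c + ρ = qm ≤ q|K| + q|D_q| ≤ |L||K| + |P∩L||L| + ρ ≤ |P||L| + ρ,
-- where the middle step is the hypothesis W₀(S) ≥ 0.

-- The elements of the deduplicated ys
-- that occur in xs form a duplicate-free list with the same members as xs,
-- hence a permutation of xs.
unique-⊆⇒length-≤ : ∀ {A : Set} → DecidableEquality A → {xs ys : List A} →
  Unique xs → (∀ {x} → x ∈ xs → x ∈ ys) → length xs ≤ℕ length ys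
unique-⊆⇒length-≤ {A} _≟_ {xs} {ys} xs! xs⊆ys = begin
  length xs   ≡⟨ ↭-length (∼bag⇒↭ (unique∧set⇒bag xs! zs! xs≈zs)) ⟩
  length zs   ≤⟨ length-filter in-xs? ys′ ⟩
  length ys′  ≤⟨ length-deduplicate _≟_ ys ⟩
  length ys   ∎
  where
  open ℕ.≤-Reasoning
  in-xs? : Decidable (_∈ xs)
  in-xs? x = member? _≟_ x xs
  ys′ zs : List A
  ys′ = deduplicate _≟_ ys
  zs  = filter in-xs? ys′
  zs! : Unique zs
  zs! = filter⁺ in-xs? (deduplicate-! _≟_ ys)
  xs≈zs : ∀ {x} → x ∈ xs ⇔ x ∈ zs
  xs≈zs = mk⇔ (λ x∈xs → ∈-filter⁺ in-xs? (∈-deduplicate⁺ _≟_ (xs⊆ys x∈xs)) x∈xs)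
              (λ x∈zs → proj₂ (∈-filter⁻ in-xs? {xs = ys′} x∈zs))

card-dec : ∀ {A : SubsetOfℕ} {a} → HasCard A a → Decidable A
card-dec (xs , _ , xs≈A , _) n =
  map′ (Equivalence.to (xs≈A n)) (Equivalence.from (xs≈A n)) (member? _≟_ n xs)

card-≥ : ∀ {A : SubsetOfℕ} {a} {zs : List ℕ} → HasCard A a →
  Unique zs → (∀ {n} → n ∈ zs → A n) → length zs ≤ℕ a
card-≥ (xs , _ , xs≈A , refl) zs! zs⊆A =
  unique-⊆⇒length-≤ _≟_ zs! (λ {n} n∈zs → Equivalence.from (xs≈A n) (zs⊆A n∈zs))

card-cover : ∀ {A B : SubsetOfℕ} {a b} {zs : List ℕ} → HasCard A a → HasCard B b →
  Unique zs → (∀ {n} → n ∈ zs → A n ⊎ B n) → length zs ≤ℕ a +ℕ b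
card-cover {A} {B} {zs = zs} (xs , _ , xs≈A , refl) (ys , _ , ys≈B , refl) zs! zs⊆A∪B =
  subst (length zs ≤ℕ_) (length-++ xs)
    (unique-⊆⇒length-≤ _≟_ zs! λ {n} n∈zs → listed n (zs⊆A∪B n∈zs))
  where
  listed : ∀ n → A n ⊎ B n → n ∈ xs ++ ys
  listed n (inj₁ n∈A) = ∈-++⁺ˡ (Equivalence.from (xs≈A n) n∈A)
  listed n (inj₂ n∈B) = ∈-++⁺ʳ xs (Equivalence.from (ys≈B n) n∈B)

card-disjoint-≤ : ∀ {A B C : SubsetOfℕ} {a b c} →
  HasCard A a → HasCard B b → HasCard C c →
  (∀ {n} → A n → B n → ⊥) → (∀ {n} → A n → C n) → (∀ {n} → B n → C n) →
  a +ℕ b ≤ℕ c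
card-disjoint-≤ {C = C} {c = c} (xs , xs! , xs≈A , refl) (ys , ys! , ys≈B , refl) hasC A∩B=∅ A⊆C B⊆C =
  subst (_≤ℕ c) (length-++ xs)
    (card-≥ hasC (++⁺ xs! ys! disjoint) inC)
  where
  disjoint : ∀ {n} → ¬ (n ∈ xs × n ∈ ys)
  disjoint {n} (n∈xs , n∈ys) =
    A∩B=∅ (Equivalence.to (xs≈A n) n∈xs) (Equivalence.to (ys≈B n) n∈ys)
  inC : ∀ {n} → n ∈ xs ++ ys → C n
  inC {n} n∈ with ∈-++⁻ xs n∈
  ... | inj₁ n∈xs = A⊆C (Equivalence.to (xs≈A n) n∈xs)
  ... | inj₂ n∈ys = B⊆C (Equivalence.to (ys≈B n) n∈ys)

card-restrict : ∀ {A Q : SubsetOfℕ} {a} → HasCard A a → Decidable Q →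
  ∃[ k ] HasCard (λ n → A n × Q n) k
card-restrict (xs , xs! , xs≈A , _) Q? =
  length (filter Q? xs) ,
  filter Q? xs ,
  filter⁺ Q? xs! ,
  (λ n → mk⇔ (λ n∈ → let (n∈xs , Qn) = ∈-filter⁻ Q? {xs = xs} n∈
                     in Equivalence.to (xs≈A n) n∈xs , Qn)
             (λ (An , Qn) → ∈-filter⁺ Q? (Equivalence.from (xs≈A n) An) Qn)) ,
  refl

increasing⇒unique : ∀ (f : ℕ → ℕ) n → (∀ {i j} → i < j → f i < f j) →
  Unique (applyUpTo f n)
increasing⇒unique f n f-mono = applyUpTo⁺₁ f n (λ i<j _ → ℕ.<⇒≢ (f-mono i<j))

ceilDiv-≥ : ∀ c k → c ≤ℕ ceilDiv c (suc k) * suc k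
ceilDiv-≥ c k = ℕ.+-cancelʳ-≤ k c _ (begin
  c +ℕ k                          ≡⟨ m≡m%n+[m/n]*n (c +ℕ k) (suc k) ⟩
  (c +ℕ k) % suc k +ℕ q * suc k   ≤⟨ ℕ.+-monoˡ-≤ (q * suc k) (ℕ.≤-pred (m%n<n (c +ℕ k) (suc k))) ⟩
  k +ℕ q * suc k                  ≡⟨ ℕ.+-comm k _ ⟩
  q * suc k +ℕ k                  ∎)
  where
  open ℕ.≤-Reasoning
  q = ceilDiv c (suc k)

ceilDiv-< : ∀ c k i → i < ceilDiv c (suc k) → i * suc k < c
ceilDiv-< c k i i<q = ℕ.+-cancelʳ-≤ k (suc (i * suc k)) c (begin
  suc (i * suc k) +ℕ k        ≡⟨ cong suc (ℕ.+-comm (i * suc k) k) ⟩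
  suc i * suc k               ≤⟨ ℕ.*-monoˡ-≤ (suc k) i<q ⟩
  ceilDiv c (suc k) * suc k   ≤⟨ m/n*n≤m (c +ℕ k) (suc k) ⟩
  c +ℕ k                      ∎)
  where open ℕ.≤-Reasoning

wilf-from-counts : ∀ {c ρ q m p p₀ k d l} →
  c +ℕ ρ ≡ q * m → q * d ≤ℕ p₀ * l +ℕ ρ →
  p₀ +ℕ k ≤ℕ p → m ≤ℕ k +ℕ d → q ≤ℕ l →
  c ≤ℕ p * l
wilf-from-counts {c} {ρ} {q} {m} {p} {p₀} {k} {d} {l} c+ρ≡qm W₀ p₀+k≤p m≤k+d q≤l =
  ℕ.+-cancelʳ-≤ ρ c (p * l) (begin
    c +ℕ ρ                   ≡⟨ c+ρ≡qm ⟩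
    q * m                    ≤⟨ ℕ.*-monoʳ-≤ q m≤k+d ⟩
    q * (k +ℕ d)             ≡⟨ ℕ.*-distribˡ-+ q k d ⟩
    q * k +ℕ q * d           ≤⟨ ℕ.+-mono-≤ (ℕ.*-monoˡ-≤ k q≤l) W₀ ⟩
    l * k +ℕ (p₀ * l +ℕ ρ)   ≡⟨ regroup ⟩
    (p₀ +ℕ k) * l +ℕ ρ       ≤⟨ ℕ.+-monoˡ-≤ ρ (ℕ.*-monoˡ-≤ l p₀+k≤p) ⟩
    p * l +ℕ ρ               ∎)
  where
  open ℕ.≤-Reasoning
  regroup : l * k +ℕ (p₀ * l +ℕ ρ) ≡ (p₀ +ℕ k) * l +ℕ ρ
  regroup = begin-equality
    l * k +ℕ (p₀ * l +ℕ ρ)   ≡⟨ ℕ.+-assoc (l * k) (p₀ * l) ρ ⟨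
    l * k +ℕ p₀ * l +ℕ ρ     ≡⟨ cong (λ z → z +ℕ p₀ * l +ℕ ρ) (ℕ.*-comm l k) ⟩
    k * l +ℕ p₀ * l +ℕ ρ     ≡⟨ cong (_+ℕ ρ) (ℕ.+-comm (k * l) (p₀ * l)) ⟩
    p₀ * l +ℕ k * l +ℕ ρ     ≡⟨ cong (_+ℕ ρ) (ℕ.*-distribʳ-+ l p₀ k) ⟨
    (p₀ +ℕ k) * l +ℕ ρ       ∎

W₀-nonneg⇒ℕ : ∀ p₀ l q d ρ → + 0 ≤ (+ p₀ *ℤ + l) - (+ q *ℤ + d) + + ρ →
  q * d ≤ℕ p₀ * l +ℕ ρ
W₀-nonneg⇒ℕ p₀ l q d ρ h =
  ℤ.drop‿+≤+ (subst₂ _≤_ (sym (ℤ.pos-* q d)) A+ρ≡ (ℤ.0≤i-j⇒j≤i h′))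
  where
  A B : ℤ
  A = + p₀ *ℤ + l
  B = + q *ℤ + d
  shuffle : A - B + + ρ ≡ (A + + ρ) - B
  shuffle = trans (ℤ.+-assoc A (ℤ.- B) (+ ρ))
            (trans (cong (λ z → A + z) (ℤ.+-comm (ℤ.- B) (+ ρ))) (sym (ℤ.+-assoc A (+ ρ) (ℤ.- B))))
  h′ : + 0 ≤ (A + + ρ) - B
  h′ = subst (+ 0 ≤_) shuffle h
  A+ρ≡ : A + + ρ ≡ + (p₀ * l +ℕ ρ)
  A+ρ≡ = trans (cong (_+ + ρ) (sym (ℤ.pos-* p₀ l))) (sym (ℤ.pos-+ (p₀ * l) ρ))

ℕ⇒W-nonneg : ∀ p l c → c ≤ℕ p * l → + 0 ≤ (+ p *ℤ + l) - + c
ℕ⇒W-nonneg p l c c≤pl = ℤ.i≤j⇒0≤j-i (subst (+ c ≤_) (ℤ.pos-* p l) (ℤ.+≤+ c≤pl))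

PrimitiveBeyond : SubsetOfℕ → ℕ → SubsetOfℕ
PrimitiveBeyond S c n = Primitive S n × c ≤ℕ n

module _ {S : SubsetOfℕ} (NS : IsNumericalSemigroup S) where
  open IsNumericalSemigroup NS

  multiples∈ : ∀ {m} → S m → ∀ i → S (i * m)
  multiples∈ m∈S zero    = zero∈
  multiples∈ m∈S (suc i) = closed m∈S (multiples∈ m∈S i)

  ceilDiv-≤-left : ∀ {c m-1 l} → S (suc m-1) → HasCard (Left S c) l →
    ceilDiv c (suc m-1) ≤ℕ l
  ceilDiv-≤-left {c} {m-1} {l} m∈S hasL =
    subst (_≤ℕ l) (length-applyUpTo (_* m) q)
      (card-≥ hasL (increasing⇒unique (_* m) q (ℕ.*-monoˡ-< m)) multiples⊆L)
    where
    m q : ℕ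
    m = suc m-1
    q = ceilDiv c m
    multiples⊆L : ∀ {n} → n ∈ applyUpTo (_* m) q → Left S c n
    multiples⊆L n∈ with i , i<q , refl ← ∈-applyUpTo⁻ (_* m) n∈ =
      multiples∈ m∈S i , ceilDiv-< c m-1 i i<q

  beyond-conductor : ∀ {c m n} → (∀ x → c ≤ℕ x → S x) → 0 < c →
    Decidable (DecomposableQ S c m) → c ≤ℕ n → n < c +ℕ m →
    PrimitiveBeyond S c n ⊎ DecomposableQ S c m n
  beyond-conductor {c} {m} {n} conductor 0<c Dq? c≤n n<c+m with Dq? n
  ... | yes n∈Dq = inj₂ n∈Dq
  ... | no  n∉Dq = inj₁ ((n∈S* , λ n∈D → n∉Dq (n∈D , c≤n , n<c+m)) , c≤n)
    where
    n∈S* : NonZeroElem S n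
    n∈S* = conductor n c≤n , ℕ.m<n⇒n≢0 (ℕ.<-≤-trans 0<c c≤n)

  window-≤ : ∀ {c m k d} → (∀ x → c ≤ℕ x → S x) → 0 < c →
    HasCard (PrimitiveBeyond S c) k → HasCard (DecomposableQ S c m) d →
    m ≤ℕ k +ℕ d
  window-≤ {c} {m} {k} {d} conductor 0<c hasK hasD =
    subst (_≤ℕ k +ℕ d) (length-applyUpTo (c +ℕ_) m)
      (card-cover hasK hasD (increasing⇒unique (c +ℕ_) m (ℕ.+-monoʳ-< c)) window⊆K∪Dq)
    where
    window⊆K∪Dq : ∀ {n} → n ∈ applyUpTo (c +ℕ_) m →
      PrimitiveBeyond S c n ⊎ DecomposableQ S c m n
    window⊆K∪Dq n∈ with i , i<m , refl ← ∈-applyUpTo⁻ (c +ℕ_) n∈ =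
      beyond-conductor conductor 0<c (card-dec hasD) (ℕ.m≤m+n c i) (ℕ.+-monoʳ-< c i<m)

corollary2p3 : (S : SubsetOfℕ) → IsNumericalSemigroup S →
    (m c : ℕ) → IsMultiplicity S m → IsConductor S c →
    (p l p₀ d : ℕ) →
    HasCard (Primitive S) p →
    HasCard (Left S c) l →
    HasCard (PrimitiveLeft S c) p₀ →
    HasCard (DecomposableQ S c m) d →
    let q = ceilDiv c m
        ρ = q * m ∸ c
    in (+ 0 ≤ (+ p₀ *ℤ + l) - (+ q *ℤ + d) + + ρ) →
       (+ 0 ≤ (+ p *ℤ + l) - + c)
corollary2p3 S NS zero c ((_ , m≢0) , _) _ _ _ _ _ _ _ _ _ _ = ⊥-elim (m≢0 refl)
corollary2p3 S NS (suc _) zero _ _ p l _ _ _ _ _ _ _ = ℕ⇒W-nonneg p l 0 z≤n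
corollary2p3 S NS m@(suc m-1) c@(suc _) ((m∈S , _) , _) (conductor , _) p l p₀ d
  hasP hasL hasP₀ hasD W₀ =
  ℕ⇒W-nonneg p l c
    (wilf-from-counts (ℕ.m+[n∸m]≡n (ceilDiv-≥ c m-1)) (W₀-nonneg⇒ℕ p₀ l q d _ W₀)
      p₀+k≤p (window-≤ NS conductor (s≤s z≤n) hasK hasD) (ceilDiv-≤-left NS m∈S hasL))
  where
  q : ℕ
  q = ceilDiv c m
  beyond : ∃[ k ] HasCard (PrimitiveBeyond S c) k
  beyond = card-restrict hasP (c ≤?_)
  k : ℕ
  k = proj₁ beyond
  hasK : HasCard (PrimitiveBeyond S c) k
  hasK = proj₂ beyond
  p₀+k≤p : p₀ +ℕ k ≤ℕ p
  p₀+k≤p = card-disjoint-≤ hasP₀ hasK hasP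
    (λ (_ , n<c) (_ , c≤n) → ℕ.<⇒≱ n<c c≤n) proj₁ proj₁
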